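{- Let $p,q$ be integer words with $m(p)=m(q)$. Then $\mathrm{IncSuf}(p)=\mathrm{IncSuf}(q)$.
   Context: For an integer word $t=(t_1,\dots,t_k)$, $m(t)\in\mathbb{Z}^k$ is defined by $m(t)_k=t_k$ and for $j<k$: $m(t)_j=m(t)_{j+1}$ if $t_j\ge t_{j+1}$, $m(t)_j=\min(t_j,m(t)_{j+1}-1)$ if $t_j<t_{j+1}$. $\mathrm{IncSuf}(p)$ denotes the longest strictly increasing suffix of the word $p$. -}

module Defs where

open import Data.Integer using (ℤ; _<?_; _≤?_; _-_; 1ℤ; _⊓_)
open import Data.List using (List; []; _∷_; length)
open import Data.Nat using (ℕ) renaming (_≟_ to _≟ℕ_)
open import Data.Bool using (Bool; true; false; if_then_else_; _∧_)
open import Relation.Nullary.Decidable using (⌊_⌋)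

Word : Set
Word = List ℤ

m : Word → Word
m [] = []
m (t ∷ []) = t ∷ []
m (t ∷ u ∷ r) with m (u ∷ r)
... | [] = []   -- unreachable: m preserves nonempty words
... | mu ∷ ms = (if ⌊ t <? u ⌋ then t ⊓ (mu - 1ℤ) else mu) ∷ mu ∷ ms

-- Longest strictly increasing suffix.
-- IncSuf(t ∷ r) = t ∷ r if r is itself strictly increasing (IncSuf r = r)
-- and (r is empty or t < head r); otherwise IncSuf r.
IncSuf : Word → Word
IncSuf [] = []
IncSuf (t ∷ []) = t ∷ []
IncSuf (t ∷ u ∷ r) =
  if ⌊ length (IncSuf (u ∷ r)) ≟ℕ length (u ∷ r) ⌋ ∧ ⌊ t <? u ⌋
  then t ∷ u ∷ r
  else IncSuf (u ∷ r)

{-# OPTIONS --safe #-}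
-- m preserves length and fixes strictly increasing words, and the head of
-- m (t ∷ w) lies below the head of m w exactly when t lies below the head of w.
-- So, by induction, the test deciding whether IncSuf (t ∷ w) is the whole word
-- gives the same answer for m (t ∷ w); if it fails both sides reduce to the
-- tails, and if it succeeds t ∷ w is increasing, hence equal to m (t ∷ w).
module Submission where

open import Defs
open import Data.Bool using (Bool; true; false; if_then_else_; _∧_)
open import Data.Empty using (⊥-elim)
open import Data.Integer using (ℤ; _<_; _≤_; _<?_; _-_; _⊓_; 1ℤ)
import Data.Integer.Properties as ℤ
open import Data.List using ([]; _∷_; length)
open import Data.Nat using (suc; s≤s) renaming (_≤_ to _≤ℕ_; _≟_ to _≟ℕ_)
import Data.Nat.Properties as ℕ
open import Data.Product using (_×_; _,_)
open import Relation.Binary.PropositionalEquality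
open import Relation.Nullary using (Dec; yes; no)
open import Relation.Nullary.Decidable using (⌊_⌋)

private
  variable
    A : Set

if-cong₂-guarded : ∀ b {x y z w : A} → (b ≡ true → x ≡ z) → y ≡ w →
                   (if b then x else y) ≡ (if b then z else w)
if-cong₂-guarded true  x≡z _   = x≡z refl
if-cong₂-guarded false _   y≡w = y≡w

i<j⇒i≤j-1 : ∀ {i j} → i < j → i ≤ j - 1ℤ
i<j⇒i≤j-1 {i} {j} i<j = subst (i ≤_) (ℤ.+-comm _ j) (ℤ.i<j⇒i≤pred[j] i<j)

i⊓[j-1]<j : ∀ i j → i ⊓ (j - 1ℤ) < j
i⊓[j-1]<j i j = ℤ.≤-<-trans (ℤ.i⊓j≤j i (j - 1ℤ)) (ℤ.i≤pred[j]⇒i<j (ℤ.≤-reflexive (ℤ.+-comm j _)))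

-- This is the test in the definition of IncSuf; it holds iff w is strictly increasing.
Increasing : Word → Set
Increasing w = length (IncSuf w) ≡ length w

increasing? : (w : Word) → Dec (Increasing w)
increasing? w = length (IncSuf w) ≟ℕ length w

length-m : (w : Word) → length (m w) ≡ length w
length-m []          = refl
length-m (t ∷ [])    = refl
length-m (t ∷ u ∷ r) with m (u ∷ r) | length-m (u ∷ r)
... | mu ∷ ms | eq = cong suc eq

length-IncSuf-≤ : (w : Word) → length (IncSuf w) ≤ℕ length w
length-IncSuf-≤ []          = ℕ.≤-refl
length-IncSuf-≤ (t ∷ [])    = ℕ.≤-refl
length-IncSuf-≤ (t ∷ u ∷ r) with ⌊ increasing? (u ∷ r) ⌋ ∧ ⌊ t <? u ⌋ | length-IncSuf-≤ (u ∷ r)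
... | true  | _  = ℕ.≤-refl
... | false | ih = ℕ.m≤n⇒m≤1+n ih

Increasing-∷⁻ : ∀ t u r → Increasing (t ∷ u ∷ r) → Increasing (u ∷ r) × t < u
Increasing-∷⁻ t u r inc with increasing? (u ∷ r) | t <? u
... | yes tail-inc | yes t<u = tail-inc , t<u
... | yes _        | no _    = ⊥-elim (ℕ.<⇒≢ (s≤s (length-IncSuf-≤ (u ∷ r))) inc)
... | no _         | _       = ⊥-elim (ℕ.<⇒≢ (s≤s (length-IncSuf-≤ (u ∷ r))) inc)

Increasing-∷⁺ : ∀ t u r → ⌊ increasing? (u ∷ r) ⌋ ∧ ⌊ t <? u ⌋ ≡ true → Increasing (t ∷ u ∷ r)
Increasing-∷⁺ t u r pass = cong (λ b → length (if b then t ∷ u ∷ r else IncSuf (u ∷ r))) pass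

-- The left operand of _<?_ is the head of m (t ∷ u ∷ r) when m (u ∷ r) starts with mu.
m-head-< : ∀ t u mu → ⌊ (if ⌊ t <? u ⌋ then t ⊓ (mu - 1ℤ) else mu) <? mu ⌋ ≡ ⌊ t <? u ⌋
m-head-< t u mu with t <? u
... | yes _ with t ⊓ (mu - 1ℤ) <? mu
...   | yes _   = refl
...   | no x≮mu = ⊥-elim (x≮mu (i⊓[j-1]<j t mu))
m-head-< t u mu | no _ with mu <? mu
...   | yes mu<mu = ⊥-elim (ℤ.<-irrefl refl mu<mu)
...   | no _      = refl

m-fixes-∷ : ∀ {t u r} → m (u ∷ r) ≡ u ∷ r → t < u → m (t ∷ u ∷ r) ≡ t ∷ u ∷ r
m-fixes-∷ {t} {u} fixed t<u rewrite fixed with t <? u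
... | yes _   = cong (_∷ _) (ℤ.i≤j⇒i⊓j≡i (i<j⇒i≤j-1 t<u))
... | no t≮u = ⊥-elim (t≮u t<u)

m-increasing : (w : Word) → Increasing w → m w ≡ w
m-increasing []          _   = refl
m-increasing (t ∷ [])    _   = refl
m-increasing (t ∷ u ∷ r) inc =
  let tail-inc , t<u = Increasing-∷⁻ t u r inc
  in m-fixes-∷ (m-increasing (u ∷ r) tail-inc) t<u

⌊increasing?⌋-cong : ∀ {v w} → IncSuf v ≡ IncSuf w → length v ≡ length w →
                     ⌊ increasing? v ⌋ ≡ ⌊ increasing? w ⌋
⌊increasing?⌋-cong eqI eqL = cong₂ (λ a b → ⌊ a ≟ℕ b ⌋) (cong length eqI) eqL

IncSuf-m : (w : Word) → IncSuf (m w) ≡ IncSuf w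
IncSuf-m []          = refl
IncSuf-m (t ∷ [])    = refl
IncSuf-m (t ∷ u ∷ r)
  -- abstracting m (u ∷ r) turns the type of fixed into Increasing (t ∷ u ∷ r) → x ∷ mu ∷ ms ≡ t ∷ u ∷ r
  with m (u ∷ r) | length-m (u ∷ r) | IncSuf-m (u ∷ r) | m-increasing (t ∷ u ∷ r)
... | mu ∷ ms | len | ih | fixed = begin
  (if ⌊ increasing? (mu ∷ ms) ⌋ ∧ ⌊ x <? mu ⌋ then x ∷ mu ∷ ms else IncSuf (mu ∷ ms))
    ≡⟨ cong₂ (λ (b c : Bool) → if b ∧ c then x ∷ mu ∷ ms else IncSuf (mu ∷ ms))
             (⌊increasing?⌋-cong {mu ∷ ms} {u ∷ r} ih len) (m-head-< t u mu) ⟩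
  (if ⌊ increasing? (u ∷ r) ⌋ ∧ ⌊ t <? u ⌋ then x ∷ mu ∷ ms else IncSuf (mu ∷ ms))
    ≡⟨ if-cong₂-guarded (⌊ increasing? (u ∷ r) ⌋ ∧ ⌊ t <? u ⌋)
                        (λ pass → fixed (Increasing-∷⁺ t u r pass)) ih ⟩
  IncSuf (t ∷ u ∷ r) ∎
  where
  open ≡-Reasoning
  x : ℤ
  x = if ⌊ t <? u ⌋ then t ⊓ (mu - 1ℤ) else mu

proposition5p5 : (p q : Word) → m p ≡ m q → IncSuf p ≡ IncSuf q
proposition5p5 p q mp≡mq = begin
  IncSuf p     ≡⟨ IncSuf-m p ⟨
  IncSuf (m p) ≡⟨ cong IncSuf mp≡mq ⟩
  IncSuf (m q) ≡⟨ IncSuf-m q ⟩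
  IncSuf q     ∎
  where open ≡-Reasoning
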